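{- Let $\mathcal{N}=(\mathcal{T},\mathcal{C}_{\texttt{t}_1}\cup\mathcal{C}_{\texttt{t}_2}\cup\mathcal{C}_{\texttt{t}_3})$ be an RDTN such that the 2-CNF formula $\textsc{Cl}_{\mathcal{N}}$ is satisfiable, let $\phi$ be a satisfying assignment of $\textsc{Cl}_{\mathcal{N}}$, and let $\check\varphi_{\mathcal{N}}(T)=\max_{c\in\mathcal{C}_{\texttt{t}_3}}\hat\varphi[d^\phi_c](T)$ for $T\in\mathcal{T}$. Then $\check\varphi_{\mathcal{N}}$ satisfies every constraint in $\mathcal{C}_{\texttt{t}_1}$.
   Context: An RDTN is $(\mathcal{T},\mathcal{C}_{\texttt{t}_1}\cup\mathcal{C}_{\texttt{t}_2}\cup\mathcal{C}_{\texttt{t}_3})$ with $\mathcal{T}$ a finite totally ordered set of time-points and constraints: ($\texttt{t}_1$) $(Y-X\le w_{X,Y})$, $X,Y\in\mathcal{T}$, $w\in\mathbb{R}$; ($\texttt{t}_2$) $\bigvee_{i=1}^k(l_i\le X\le u_i)$, $X\in\mathcal{T}$, $l_i,u_i\in\mathbb{R}$; ($\texttt{t}_3$) $(l_1\le X\le u_1)\vee(l_2\le Y\le u_2)$ with $X$ preceding $Y$ in the order; $d'_c=(l_1\le X\le u_1)$ and $d''_c=(l_2\le Y\le u_2)$ are the first and second disjunct of such $c$. A schedule $s:\mathcal{T}\to\mathbb{R}$ is feasible if it satisfies all constraints. The least feasible schedule of a consistent network is the non-negative feasible schedule that is pointwise $\le$ every non-negative feasible schedule. For a disjunct $d=(l\le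 X\le u)$ of some $c\in\mathcal{C}_{\texttt{t}_3}$, $\mathcal{N}[d]_{\texttt{t}_2}$ is the network with time-points $\mathcal{T}\cup\{z\}$ and constraints $\mathcal{C}_{\texttt{t}_1}\cup\{(z-X\le -l),(X-z\le u)\}\cup\{(z-T\le0)\mid T\in\mathcal{T}\}\cup\mathcal{C}_{\texttt{t}_2}$; when consistent, $\hat\varphi[d]$ denotes its least feasible schedule. The 2-CNF $\textsc{Cl}_{\mathcal{N}}$ over variables $\{x_c\}_{c\in\mathcal{C}_{\texttt{t}_3}}$ contains, for each $c\in\mathcal{C}_{\texttt{t}_3}$: the clause $\neg x_c$ if $\mathcal{N}[d'_c]_{\texttt{t}_2}$ is inconsistent, otherwise for each $\tilde c=(\tilde l_1\le X_{\tilde i}\le\tilde u_1)\vee(\tilde l_2\le X_{\tilde j}\le\tilde u_2)\in\mathcal{C}_{\texttt{t}_3}$, $\tilde c\ne c$, the clause $\neg x_c\vee\neg x_{\tilde c}$ if $\hat\varphi[d'_c](X_{\tilde i})>\tilde u_1$ and the clause $\neg x_c\vee x_{\tilde c}$ if $\hat\varphi[d'_c](X_{\tilde j})>\tilde u_2$; and the clause $x_c$ if $\mathcal{N}[d''_c]_{\texttt{t}_2}$ is inconsistent, otherwise for each such $\tilde c\neq c$ the clause $x_c\vee\neg x_{\tilde c}$ if $\hat\varphi[d''_c](X_{\tilde i})>\tilde u_1$ and $x_c\vee x_{\tilde c}$ if $\hat\varphi[d''_c](X_{\tilde j})>\tilde u_2$. For a satisfying assignment $\phi$, $d^\phi_c=d'_c$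 if $\phi(x_c)=\texttt{true}$ and $d^\phi_c=d''_c$ otherwise. -}

module Defs where

open import Level using (0ℓ)
open import Data.Nat as ℕ using (ℕ; zero; suc)
open import Data.Fin using (Fin; toℕ)
open import Data.Bool using (Bool; true; false; if_then_else_)
open import Data.List using (List)
open import Data.List.Relation.Unary.All using (All)
open import Data.List.Relation.Unary.Any using (Any)
open import Data.Product using (Σ; ∃; _×_; _,_)
open import Data.Sum using (_⊎_)
open import Relation.Nullary using (¬_; Dec; yes; no)
open import Relation.Binary.PropositionalEquality using (_≡_; _≢_)
open import Relation.Binary using (IsTotalOrder; Decidable)
open import Algebra.Structures using (IsCommutativeRing)

-- The real numbers, given axiomatically as a (Dedekind-)complete ordered
-- field with propositional equality and decidable order (classical ℝ).
-- agda-stdlib has no real numbers; every model of this record is ℝ.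

record Reals : Set₁ where
  infixl 6 _+_
  infixl 7 _*_
  infix 4 _≤_
  field
    ℝ   : Set
    _+_ : ℝ → ℝ → ℝ
    _*_ : ℝ → ℝ → ℝ
    -_  : ℝ → ℝ
    0#  : ℝ
    1#  : ℝ
    _≤_ : ℝ → ℝ → Set
    isCommutativeRing : IsCommutativeRing _≡_ _+_ _*_ -_ 0# 1#
    0≢1      : 0# ≢ 1#
    inverse  : ∀ x → x ≢ 0# → ∃ λ y → x * y ≡ 1#
    isTotalOrder : IsTotalOrder _≡_ _≤_
    _≤?_     : Decidable _≤_
    +-mono-≤ : ∀ {x y} z → x ≤ y → x + z ≤ y + z
    *-nonneg : ∀ {x y} → 0# ≤ x → 0# ≤ y → 0# ≤ x * y
    complete : (P : ℝ → Set) → ∃ P → (∃ λ b → ∀ x → P x → x ≤ b) →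
               ∃ λ s → (∀ x → P x → x ≤ s) × (∀ b → (∀ x → P x → x ≤ b) → s ≤ b)

  infixl 6 _-_
  _-_ : ℝ → ℝ → ℝ
  x - y = x + (- y)

  infix 4 _<_
  _<_ : ℝ → ℝ → Set
  x < y = x ≤ y × x ≢ y

  max : ℝ → ℝ → ℝ
  max x y with x ≤? y
  ... | yes _ = y
  ... | no  _ = x

-- Restricted disjunctive temporal networks (RDTN).
-- Time-points are Fin n, totally ordered by their index.

module _ (R : Reals) where
  open Reals R

  -- t1 constraint  (Y - X ≤ w)
  record T1 (n : ℕ) : Set where
    field
      X Y : Fin n
      w   : ℝ

  -- t2 constraint  ⋁_i (l_i ≤ X ≤ u_i)
  record T2 (n : ℕ) : Set where
    field
      X         : Fin n
      intervals : List (ℝ × ℝ)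

  -- a disjunct (l ≤ X ≤ u)
  record Disjunct (n : ℕ) : Set where
    field
      X  : Fin n
      l u : ℝ

  -- t3 constraint  (l1 ≤ X ≤ u1) ∨ (l2 ≤ Y ≤ u2), X preceding Y
  record T3 (n : ℕ) : Set where
    field
      X    : Fin n
      l₁ u₁ : ℝ
      Y    : Fin n
      l₂ u₂ : ℝ
      X≺Y  : toℕ X ℕ.< toℕ Y

  record RDTN : Set where
    field
      n   : ℕ
      C₁  : List (T1 n)
      C₂  : List (T2 n)
      m   : ℕ
      C₃  : Fin m → T3 n

module _ {R : Reals} where
  open Reals R

  sat₁ : ∀ {n} → (Fin n → ℝ) → T1 R n → Set
  sat₁ s c = s (T1.Y c) - s (T1.X c) ≤ T1.w c

  sat₂ : ∀ {n} → (Fin n → ℝ) → T2 R n → Set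
  sat₂ s c = Any (λ { (l , u) → l ≤ s (T2.X c) × s (T2.X c) ≤ u }) (T2.intervals c)

  module _ (N : RDTN R) where
    open RDTN N

    d′ : Fin m → Disjunct R n
    d′ c = record { X = T3.X (C₃ c) ; l = T3.l₁ (C₃ c) ; u = T3.u₁ (C₃ c) }

    d″ : Fin m → Disjunct R n
    d″ c = record { X = T3.Y (C₃ c) ; l = T3.l₂ (C₃ c) ; u = T3.u₂ (C₃ c) }

    -- Feasibility of a schedule (s on 𝒯, value z for the extra point z)
    -- for the network 𝒩[d]_t2.
    Feasible[_] : Disjunct R n → (Fin n → ℝ) → ℝ → Set
    Feasible[ d ] s z =
      All (sat₁ s) C₁ ×
      (z - s (Disjunct.X d) ≤ - Disjunct.l d) ×
      (s (Disjunct.X d) - z ≤ Disjunct.u d) ×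
      (∀ T → z - s T ≤ 0#) ×
      All (sat₂ s) C₂

    Consistent[_] : Disjunct R n → Set
    Consistent[ d ] = ∃ λ s → ∃ λ z → Feasible[ d ] s z

    NonNeg : (Fin n → ℝ) → ℝ → Set
    NonNeg s z = (∀ T → 0# ≤ s T) × 0# ≤ z

    IsLeast[_] : Disjunct R n → (Fin n → ℝ) → ℝ → Set
    IsLeast[ d ] s z =
      Feasible[ d ] s z × NonNeg s z ×
      (∀ s′ z′ → Feasible[ d ] s′ z′ → NonNeg s′ z′ →
         (∀ T → s T ≤ s′ T) × z ≤ z′)

    data Lit : Set where
      pos neg : Fin m → Lit

    data Clause : Set where
      unit : Lit → Clause
      bin  : Lit → Lit → Clause

    ⟦_⟧ˡ : Lit → (Fin m → Bool) → Set
    ⟦ pos c ⟧ˡ φ = φ c ≡ true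
    ⟦ neg c ⟧ˡ φ = φ c ≡ false

    ⟦_⟧ᶜ : Clause → (Fin m → Bool) → Set
    ⟦ unit a ⟧ᶜ φ  = ⟦ a ⟧ˡ φ
    ⟦ bin a b ⟧ᶜ φ = ⟦ a ⟧ˡ φ ⊎ ⟦ b ⟧ˡ φ

    data _∈Cl : Clause → Set where
      incons′ : ∀ c → ¬ Consistent[ d′ c ] → unit (neg c) ∈Cl
      first′  : ∀ c c̃ s z → IsLeast[ d′ c ] s z → c̃ ≢ c →
                T3.u₁ (C₃ c̃) < s (T3.X (C₃ c̃)) → bin (neg c) (neg c̃) ∈Cl
      second′ : ∀ c c̃ s z → IsLeast[ d′ c ] s z → c̃ ≢ c →
                T3.u₂ (C₃ c̃) < s (T3.Y (C₃ c̃)) → bin (neg c) (pos c̃) ∈Cl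
      incons″ : ∀ c → ¬ Consistent[ d″ c ] → unit (pos c) ∈Cl
      first″  : ∀ c c̃ s z → IsLeast[ d″ c ] s z → c̃ ≢ c →
                T3.u₁ (C₃ c̃) < s (T3.X (C₃ c̃)) → bin (pos c) (neg c̃) ∈Cl
      second″ : ∀ c c̃ s z → IsLeast[ d″ c ] s z → c̃ ≢ c →
                T3.u₂ (C₃ c̃) < s (T3.Y (C₃ c̃)) → bin (pos c) (pos c̃) ∈Cl

    Satisfies : (Fin m → Bool) → Set
    Satisfies φ = ∀ cl → cl ∈Cl → ⟦ cl ⟧ᶜ φ

    d[_]_ : (Fin m → Bool) → Fin m → Disjunct R n
    d[ φ ] c = if φ c then d′ c else d″ c

  maxFin : ∀ {k} → (Fin (suc k) → ℝ) → ℝ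
  maxFin {zero}  f = f Fin.zero
  maxFin {suc k} f = max (f Fin.zero) (maxFin (λ i → f (Fin.suc i)))

  maxOver : ∀ {m} → .(ℕ.NonZero m) → (Fin m → ℝ) → ℝ
  maxOver {suc k} _ f = maxFin f

module Submission where

-- The schedule φ̌ is the pointwise maximum of the finitely
-- many schedules φ̂[d^φ_c], and each of these is feasible for its network
-- 𝒩[d^φ_c]_t2, which contains every t1 constraint of 𝒩.  So it suffices
-- to show that a difference constraint  Y − X ≤ w  is preserved by
-- pointwise maxima of finitely many schedules.  Indeed the maximum at Y
-- is attained by some schedule s_i, and the maximum at X is at least
-- s_i(X), so
--     max_c s_c(Y) − max_c s_c(X)  ≤  s_i(Y) − s_i(X)  ≤  w.

open import Defs
open import Data.Nat using (zero; suc; NonZero)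
open import Data.Fin using (Fin)
open import Data.Bool using (Bool)
open import Data.List using (List)
open import Data.List.Relation.Unary.All using (All)
import Data.List.Relation.Unary.All as All
open import Data.Empty using (⊥-elim)
open import Data.Product using (∃; _,_; proj₁)
open import Data.Sum using (_⊎_; inj₁; inj₂)
open import Relation.Nullary using (yes; no)
open import Relation.Binary.PropositionalEquality
  using (_≡_; refl; sym; trans; cong; subst; subst₂; module ≡-Reasoning)
open import Relation.Binary using (IsTotalOrder)
open import Algebra.Structures using (IsCommutativeRing)

module FiniteMaxima (R : Reals) where
  open Reals R
  open IsCommutativeRing isCommutativeRing
    using (+-assoc; +-comm; -‿inverseʳ; +-identityˡ)
  open IsTotalOrder isTotalOrder using (total) renaming (trans to ≤-trans)

  ≤-refl : ∀ {x} → x ≤ x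
  ≤-refl = IsTotalOrder.reflexive isTotalOrder refl

  max-upperˡ : ∀ x y → x ≤ max x y
  max-upperˡ x y with x ≤? y
  ... | yes x≤y = x≤y
  ... | no  _   = ≤-refl

  max-upperʳ : ∀ x y → y ≤ max x y
  max-upperʳ x y with x ≤? y
  ... | yes _   = ≤-refl
  ... | no  x≰y with total x y
  ...   | inj₁ x≤y = ⊥-elim (x≰y x≤y)
  ...   | inj₂ y≤x = y≤x

  max-selective : ∀ x y → max x y ≡ x ⊎ max x y ≡ y
  max-selective x y with x ≤? y
  ... | yes _ = inj₂ refl
  ... | no  _ = inj₁ refl

  maxFin-upper : ∀ {k} (f : Fin (suc k) → ℝ) i → f i ≤ maxFin {R} f
  maxFin-upper {zero}  f Fin.zero    = ≤-refl
  maxFin-upper {suc k} f Fin.zero    = max-upperˡ _ _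
  maxFin-upper {suc k} f (Fin.suc i) =
    ≤-trans (maxFin-upper (λ j → f (Fin.suc j)) i) (max-upperʳ _ _)

  maxFin-attained : ∀ {k} (f : Fin (suc k) → ℝ) → ∃ λ i → maxFin {R} f ≡ f i
  maxFin-attained {zero}  f = Fin.zero , refl
  maxFin-attained {suc k} f
    with max-selective (f Fin.zero) (maxFin {R} (λ i → f (Fin.suc i)))
  ... | inj₁ max≡head = Fin.zero , max≡head
  ... | inj₂ max≡tail with maxFin-attained (λ i → f (Fin.suc i))
  ...   | i , tail≡fi = Fin.suc i , trans max≡tail tail≡fi

  maxOver-upper : ∀ {m} (ne : NonZero m) (f : Fin m → ℝ) i → f i ≤ maxOver {R} ne f
  maxOver-upper {suc k} ne f i = maxFin-upper f i

  maxOver-attained : ∀ {m} (ne : NonZero m) (f : Fin m → ℝ) →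
                     ∃ λ i → maxOver {R} ne f ≡ f i
  maxOver-attained {zero}  ne f = ⊥-elim (NonZero.nonZero ne)
  maxOver-attained {suc k} ne f = maxFin-attained f

  -- Negation reverses the order: add −x − y to both sides of x ≤ y.

  neg-antitone : ∀ {x y} → x ≤ y → - y ≤ - x
  neg-antitone {x} {y} x≤y =
    subst₂ _≤_ (cancel x (- y)) right (+-mono-≤ (- x + - y) x≤y)
    where
    open ≡-Reasoning
    cancel : ∀ a b → a + (- a + b) ≡ b
    cancel a b = begin
      a + (- a + b)   ≡⟨ sym (+-assoc a (- a) b) ⟩
      (a + - a) + b   ≡⟨ cong (_+ b) (-‿inverseʳ a) ⟩
      0# + b          ≡⟨ +-identityˡ b ⟩
      b               ∎
    right : y + (- x + - y) ≡ - x
    right = trans (cong (y +_) (+-comm (- x) (- y))) (cancel y (- x))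

  sub-antitoneʳ : ∀ c {a b} → a ≤ b → c - b ≤ c - a
  sub-antitoneʳ c a≤b =
    subst₂ _≤_ (+-comm _ c) (+-comm _ c) (+-mono-≤ c (neg-antitone a≤b))

  sat₁-maxOver : ∀ {n m} (ne : NonZero m) (s : Fin m → Fin n → ℝ) (t : T1 R n) →
                 (∀ c → sat₁ (s c) t) → sat₁ (λ T → maxOver {R} ne (λ c → s c T)) t
  sat₁-maxOver ne s t all-sat
    with maxOver-attained ne (λ c → s c (T1.Y t))
  ... | i , maxY≡siY =
    subst (λ v → v - maxX ≤ T1.w t) (sym maxY≡siY)
      (≤-trans (sub-antitoneʳ (s i (T1.Y t))
                 (maxOver-upper ne (λ c → s c (T1.X t)) i))
               (all-sat i))
    where
    maxX : ℝ
    maxX = maxOver {R} ne (λ c → s c (T1.X t))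

  All-sat₁-maxOver : ∀ {n m} (ne : NonZero m) (s : Fin m → Fin n → ℝ)
                     (C : List (T1 R n)) → (∀ c → All (sat₁ (s c)) C) →
                     All (sat₁ (λ T → maxOver {R} ne (λ c → s c T))) C
  All-sat₁-maxOver {R} ne s C all-sat =
    All.tabulate λ t∈C → sat₁-maxOver {R} ne s _ (λ c → All.lookup (all-sat c) t∈C)

proposition2 : (R : Reals) (N : RDTN R) (ne : NonZero (RDTN.m N))
               (φ : Fin (RDTN.m N) → Bool) → Satisfies N φ →
               (ψ : Fin (RDTN.m N) → Fin (RDTN.n N) → Reals.ℝ R)
               (ζ : Fin (RDTN.m N) → Reals.ℝ R) →
               (∀ c → IsLeast[_] N (d[_]_ N φ c) (ψ c) (ζ c)) →
               All (sat₁ (λ T → maxOver {R} ne (λ c → ψ c T))) (RDTN.C₁ N)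
proposition2 R N ne φ _ ψ ζ least =
  All-sat₁-maxOver ne ψ (RDTN.C₁ N) (λ c → proj₁ (proj₁ (least c)))
  where open FiniteMaxima R
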